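{- Fix integers $c \geq 0$ and $b \geq 2$, and let $S_{[c,b]}:\mathbb{Z}^+\to\mathbb{Z}^+$ be defined by $S_{[c,b]}\left(\sum_{i=0}^n a_i b^i\right) = c + \sum_{i=0}^n a_i^2$, where $\sum_{i=0}^n a_i b^i$ is the base $b$ expansion (so $0 \le a_i \le b-1$ and $a_n \neq 0$). Then: (1) If $a \in \mathbb{Z}^+$ is a multiple of $b$, then $a$ is a fixed point of $S_{[c,b]}$ if and only if $a+1$ is a fixed point of $S_{[c,b]}$. (2) Whenever $a$ and $a+1$ are both fixed points of $S_{[c,b]}$, $a$ is a multiple of $b$. (3) There is no $a \in \mathbb{Z}^+$ such that $a$, $a+1$, and $a+2$ are all fixed points of $S_{[c,b]}$.
   Context: $S_{[c,b]}$ is the augmented generalized happy function: it maps a positive integer to $c$ plus the sum of the squares of its base $b$ digits. A fixed point of $S_{[c,b]}$ is a positive integer $a$ with $S_{[c,b]}(a)=a$. -}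

module Defs where

open import Data.Nat using (ℕ; zero; suc; _+_; _*_; _≤_; NonZero)
open import Data.Nat.DivMod using (_/_; _%_)
open import Data.List using (List; []; _∷_; map)
open import Data.Nat.ListAction using (sum)
open import Data.Product using (_×_)
open import Relation.Binary.PropositionalEquality using (_≡_)

-- With fuel ≥ n and b ≥ 2 the fuel never runs out, so
-- digits b n below is exactly the base-b expansion of n
-- (each entry < b, last entry nonzero for n > 0; empty list for n = 0).
digitsFuel : (b : ℕ) → .{{NonZero b}} → ℕ → ℕ → List ℕ
digitsFuel b zero    n       = []
digitsFuel b (suc f) zero    = []
digitsFuel b (suc f) (suc n) = (suc n % b) ∷ digitsFuel b f (suc n / b)

digits : (b : ℕ) → .{{NonZero b}} → ℕ → List ℕ
digits b n = digitsFuel b n n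

S : (c b : ℕ) → .{{NonZero b}} → ℕ → ℕ
S c b n = c + sum (map (λ d → d * d) (digits b n))

FixedPoint : (c b : ℕ) → .{{NonZero b}} → ℕ → Set
FixedPoint c b a = 1 ≤ a × S c b a ≡ a

{-# OPTIONS --safe #-}
-- Write D n for the sum of the squares of the base-b digits of n, so that
-- S = c + D.  If a and a + 1 are both fixed points then D (a + 1) = D a + 1.
-- Incrementing a number whose last digit r is below b − 1 raises D by exactly
-- 2r + 1, which equals 1 only for r = 0; incrementing through a carry never
-- raises D, because D grows by at most (b − 1)² per increment.  So the pair
-- forces b ∣ a, the converse is the r = 0 computation, and three consecutive
-- fixed points would make b divide two consecutive numbers.
module Submission where

open import Defs
open import Data.Nat using (ℕ; zero; suc; _+_; _*_; _≤_; _<_; NonZero; z≤n; s≤s; z<s)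
open import Data.Nat.Properties
open import Data.Nat.DivMod
open import Data.Nat.Divisibility using (_∣_; divides; ∣1⇒≡1; ∣m+n∣m⇒∣n)
open import Data.Nat.Induction using (<-rec)
open import Data.Nat.Tactic.RingSolver using (solve-∀)
open import Data.List using (_∷_; map)
open import Data.Nat.ListAction using (sum)
open import Data.Product using (_×_; _,_)
open import Data.Sum using (inj₁; inj₂)
open import Function using (_∘_)
open import Function.Bundles using (_⇔_; mk⇔; Equivalence)
open import Relation.Nullary using (¬_; contradiction)
open import Relation.Binary.PropositionalEquality

digitSquareSum : (b : ℕ) → .{{NonZero b}} → ℕ → ℕ
digitSquareSum b n = sum (map (λ d → d * d) (digits b n))

suc[m+m]≤n*n : ∀ {m n} → m < n → suc (m + m) ≤ n * n
suc[m+m]≤n*n {m} m<n = ≤-trans (s≤s (+-monoʳ-≤ m (m≤m*n m (suc m)))) (*-mono-≤ m<n m<n)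

[1+m]²+n≡m²+n+[1+2m] : ∀ m n → suc m * suc m + n ≡ m * m + n + suc (m + m)
[1+m]²+n≡m²+n+[1+2m] = solve-∀

-- The base is b = 2 + k, whose top digit is 1 + k.
module _ (k : ℕ) where

  private
    b : ℕ
    b = suc (suc k)

    D : ℕ → ℕ
    D = digitSquareSum b

    1<b : 1 < b
    1<b = s≤s (s≤s z≤n)

  suc-/-≤ : ∀ n → suc n / b ≤ n
  suc-/-≤ n = ≤-pred (m/n<m (suc n) b 1<b)

  digitsFuel-cong : ∀ {f g n} → n ≤ f → n ≤ g → digitsFuel b f n ≡ digitsFuel b g n
  digitsFuel-cong {zero}  {zero}  z≤n z≤n = refl
  digitsFuel-cong {zero}  {suc g} z≤n _   = refl
  digitsFuel-cong {suc f} {zero}  _   z≤n = refl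
  digitsFuel-cong {suc f} {suc g} {zero}  _ _ = refl
  digitsFuel-cong {suc f} {suc g} {suc n} (s≤s n≤f) (s≤s n≤g) =
    cong (suc n % b ∷_) (digitsFuel-cong (≤-trans (suc-/-≤ n) n≤f) (≤-trans (suc-/-≤ n) n≤g))

  digitSquareSum-%-/ : ∀ n → D n ≡ n % b * (n % b) + D (n / b)
  digitSquareSum-%-/ zero    = refl
  digitSquareSum-%-/ (suc n) =
    cong (λ ds → sum (map (λ d → d * d) (suc n % b ∷ ds))) (digitsFuel-cong (suc-/-≤ n) ≤-refl)

  digitSquareSum-lastDigit : ∀ {r} q → r < b → D (r + q * b) ≡ r * r + D q
  digitSquareSum-lastDigit {r} q r<b =
    trans (digitSquareSum-%-/ (r + q * b)) (cong₂ (λ x y → x * x + D y) %≡ /≡)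
    where
    %≡ : (r + q * b) % b ≡ r
    %≡ = trans ([m+kn]%n≡m%n r q b) (m<n⇒m%n≡m r<b)
    /≡ : (r + q * b) / b ≡ q
    /≡ = trans (+-distrib-/-∣ʳ r (divides q refl)) (cong₂ _+_ (m<n⇒m/n≡0 r<b) (m*n/n≡m q b))

  digitSquareSum-suc-multiple : ∀ {a} → b ∣ a → D (suc a) ≡ suc (D a)
  digitSquareSum-suc-multiple (divides q refl) =
    trans (digitSquareSum-lastDigit q 1<b) (cong suc (sym (digitSquareSum-lastDigit q z<s)))

  digitSquareSum-suc-nonTop : ∀ {r} q → r < suc k → D (suc (r + q * b)) ≡ D (r + q * b) + suc (r + r)
  digitSquareSum-suc-nonTop {r} q r<t = begin
    D (suc r + q * b)          ≡⟨ digitSquareSum-lastDigit q (s≤s r<t) ⟩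
    suc r * suc r + D q        ≡⟨ [1+m]²+n≡m²+n+[1+2m] r (D q) ⟩
    r * r + D q + suc (r + r)  ≡⟨ cong (_+ suc (r + r)) (sym (digitSquareSum-lastDigit q (m<n⇒m<1+n r<t))) ⟩
    D (r + q * b) + suc (r + r) ∎
    where open ≡-Reasoning

  digitSquareSum-suc-carry : ∀ q → D (suc q) ≤ D q + suc k * suc k →
                             D (suc (suc k + q * b)) ≤ D (suc k + q * b)
  digitSquareSum-suc-carry q D[1+q]≤ = begin
    D (0 + suc q * b)         ≡⟨ digitSquareSum-lastDigit (suc q) z<s ⟩
    D (suc q)                 ≤⟨ D[1+q]≤ ⟩
    D q + suc k * suc k       ≡⟨ +-comm (D q) _ ⟩
    suc k * suc k + D q       ≡⟨ digitSquareSum-lastDigit q ≤-refl ⟨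
    D (suc k + q * b)         ∎
    where open ≤-Reasoning

  digitSquareSum-suc-≤ : ∀ n → D (suc n) ≤ D n + suc k * suc k
  digitSquareSum-suc-≤ = <-rec _ λ n rec →
    let n≡ = sym (m≡m%n+[m/n]*n n b) in
    subst (λ m → D (suc m) ≤ D m + suc k * suc k) n≡
      (byLastDigit (m%n<n n b) (rec ∘ subst (n / b <_) n≡))
    where
    byLastDigit : ∀ {r q} → r < b → (q < r + q * b → D (suc q) ≤ D q + suc k * suc k) →
                  D (suc (r + q * b)) ≤ D (r + q * b) + suc k * suc k
    byLastDigit {r} {q} r<b rec with m≤n⇒m<n∨m≡n (≤-pred r<b)
    ... | inj₁ r<t = ≤-trans (≤-reflexive (digitSquareSum-suc-nonTop q r<t))
                             (+-monoʳ-≤ (D (r + q * b)) (suc[m+m]≤n*n r<t))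
    ... | inj₂ refl = ≤-trans (digitSquareSum-suc-carry q (rec q<n)) (m≤m+n _ _)
      where
      q<n : q < suc k + q * b
      q<n = ≤-<-trans (m≤m*n q b) (m<n+m (q * b) z<s)

  digitSquareSum-suc≡suc⇒∣ : ∀ n → D (suc n) ≡ suc (D n) → b ∣ n
  digitSquareSum-suc≡suc⇒∣ n =
    subst (λ m → D (suc m) ≡ suc (D m) → b ∣ m) (sym (m≡m%n+[m/n]*n n b)) (byLastDigit {n % b} {n / b} (m%n<n n b))
    where
    byLastDigit : ∀ {r q} → r < b → D (suc (r + q * b)) ≡ suc (D (r + q * b)) → b ∣ r + q * b
    byLastDigit {r} {q} r<b D-suc with m≤n⇒m<n∨m≡n (≤-pred r<b)
    ... | inj₁ r<t = divides q (cong (_+ q * b) (m+n≡0⇒m≡0 r (suc-injective 1+2r≡1)))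
      where
      1+2r≡1 : suc (r + r) ≡ 1
      1+2r≡1 = +-cancelˡ-≡ (D (r + q * b)) _ _
        (trans (sym (digitSquareSum-suc-nonTop q r<t)) (trans D-suc (+-comm 1 _)))
    ... | inj₂ refl = contradiction
      (subst (_≤ D (suc k + q * b)) D-suc (digitSquareSum-suc-carry q (digitSquareSum-suc-≤ q)))
      (n≮n _)

  S-+1⇔digitSquareSum-suc : ∀ c a → (S c b (a + 1) ≡ S c b a + 1) ⇔ (D (suc a) ≡ suc (D a))
  S-+1⇔digitSquareSum-suc c a = mk⇔
    (λ eq → +-cancelˡ-≡ c _ _ (trans (sym S[a+1]≡) (trans eq S[a]+1≡)))
    (λ eq → trans S[a+1]≡ (trans (cong (c +_) eq) (sym S[a]+1≡)))
    where
    S[a+1]≡ : S c b (a + 1) ≡ c + D (suc a)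
    S[a+1]≡ = cong (λ x → c + D x) (+-comm a 1)
    S[a]+1≡ : S c b a + 1 ≡ c + suc (D a)
    S[a]+1≡ = trans (+-comm _ 1) (sym (+-suc c (D a)))

  fixedPoint⇔fixedPoint-+1 : ∀ c a → 1 ≤ a → b ∣ a → FixedPoint c b a ⇔ FixedPoint c b (a + 1)
  fixedPoint⇔fixedPoint-+1 c a 1≤a b∣a = mk⇔
    (λ (_ , Sa≡a) → ≤-trans 1≤a (m≤m+n a 1) , trans S-+1 (cong (_+ 1) Sa≡a))
    (λ (_ , S[a+1]≡a+1) → 1≤a , +-cancelʳ-≡ _ _ _ (trans (sym S-+1) S[a+1]≡a+1))
    where
    S-+1 : S c b (a + 1) ≡ S c b a + 1
    S-+1 = Equivalence.from (S-+1⇔digitSquareSum-suc c a) (digitSquareSum-suc-multiple b∣a)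

  fixedPoint-pair⇒∣ : ∀ c a → FixedPoint c b a → FixedPoint c b (a + 1) → b ∣ a
  fixedPoint-pair⇒∣ c a (_ , Sa≡a) (_ , S[a+1]≡a+1) =
    digitSquareSum-suc≡suc⇒∣ a
      (Equivalence.to (S-+1⇔digitSquareSum-suc c a) (trans S[a+1]≡a+1 (cong (_+ 1) (sym Sa≡a))))

  ¬fixedPoint-triple : ∀ c a → ¬ (FixedPoint c b a × FixedPoint c b (a + 1) × FixedPoint c b (a + 2))
  ¬fixedPoint-triple c a (fa , fa+1 , fa+2) = b≢1 (∣1⇒≡1 (∣m+n∣m⇒∣n b∣a+1 b∣a))
    where
    b≢1 : b ≢ 1
    b≢1 ()
    b∣a : b ∣ a
    b∣a = fixedPoint-pair⇒∣ c a fa fa+1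
    b∣a+1 : b ∣ a + 1
    b∣a+1 = fixedPoint-pair⇒∣ c (a + 1) fa+1 (subst (FixedPoint c b) (sym (+-assoc a 1 1)) fa+2)

theorem2p1 : (c b : ℕ) → .{{_ : NonZero b}} → 2 ≤ b →
    ((a : ℕ) → 1 ≤ a → b ∣ a → (FixedPoint c b a ⇔ FixedPoint c b (a + 1)))
    × ((a : ℕ) → FixedPoint c b a → FixedPoint c b (a + 1) → b ∣ a)
    × ((a : ℕ) → 1 ≤ a → ¬ (FixedPoint c b a × FixedPoint c b (a + 1) × FixedPoint c b (a + 2)))
theorem2p1 c (suc (suc k)) (s≤s (s≤s z≤n)) =
  fixedPoint⇔fixedPoint-+1 k c , fixedPoint-pair⇒∣ k c , λ a _ → ¬fixedPoint-triple k c a
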